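{- Each extrapolator $m$ weakly NV-learns a dense subset of $\mathcal{C}$ of cardinality $\mathfrak{c}$ and fails to weakly NV-learn a dense subset of $\mathcal{C}$ of cardinality $\mathfrak{c}$.
   Context: $\mathcal{B}^*$ is the set of finite binary strings; $\mathcal{C}$ is the set of infinite binary sequences $\sigma=\sigma(1)\sigma(2)\dots$ with the product topology (basic open sets $B_w$ = sequences beginning with string $w$); $\sigma[k]$ is the string of the first $k$ bits; $\mathfrak{c}$ is the cardinality of the continuum. An extrapolator is any function $m:\mathcal{B}^*\to\{0,1\}$. $m$ weakly NV-learns $\sigma$ if $\lim_{n\to\infty}\frac{|\{k\le n: m(\sigma[k])=\sigma(k+1)\}|}{n}=1$. -}

module Defs where

open import Data.Nat using (ℕ; zero; suc; _+_; _*_; _∸_; _≤_)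
open import Data.Bool using (Bool; true; false; if_then_else_)
open import Data.Bool.Properties using () renaming (_≟_ to _≟B_)
open import Data.List using (List; []; _∷_; length)
open import Data.Product using (Σ; ∃; _×_; _,_)
open import Relation.Binary.PropositionalEquality using (_≡_)
open import Relation.Nullary using (¬_; does)

𝓑* : Set
𝓑* = List Bool

-- infinite binary sequences; σ i is the bit σ(i+1) of the paper (0-indexed)
𝓒 : Set
𝓒 = ℕ → Bool

prefix : 𝓒 → ℕ → 𝓑*
prefix σ zero = []
prefix σ (suc k) = σ zero ∷ prefix (λ i → σ (suc i)) k

BeginsWith : 𝓒 → 𝓑* → Set
BeginsWith σ w = prefix σ (length w) ≡ w

Extrapolator : Set
Extrapolator = 𝓑* → Bool

-- |{ k ≤ n : m(σ[k]) = σ(k+1) }|, k ranging over 1..n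
correct : Extrapolator → 𝓒 → ℕ → ℕ
correct m σ zero = 0
correct m σ (suc n) =
  (if does (m (prefix σ (suc n)) ≟B σ (suc n)) then 1 else 0) + correct m σ n

-- lim_{n→∞} correct(n)/n = 1, i.e. for every j ≥ 1 eventually the
-- fraction of errors (n - correct n)/n is at most 1/j
WeaklyNVLearns : Extrapolator → 𝓒 → Set
WeaklyNVLearns m σ =
  ∀ (j : ℕ) → ∃ λ N → ∀ n → N ≤ n → suc j * (n ∸ correct m σ n) ≤ n

_≈_ : 𝓒 → 𝓒 → Set
σ ≈ τ = ∀ i → σ i ≡ τ i

Dense : (𝓒 → Set) → Set
Dense S = ∀ (w : 𝓑*) → ∃ λ σ → S σ × BeginsWith σ w

-- S ⊆ 𝓒 has cardinality 𝔠: 𝓒 injects into S (S ⊆ 𝓒 gives the other bound)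
HasCardContinuum : (𝓒 → Set) → Set
HasCardContinuum S =
  Σ (𝓒 → 𝓒) λ f → (∀ τ → S (f τ)) × (∀ τ τ' → f τ ≈ f τ' → τ ≈ τ')

-- A plan prescribes, position by position, whether the next bit copies the
-- extrapolator's prediction, contradicts it, or is a prescribed bit; playing a
-- plan against m yields a sequence on which m errs exactly where the plan says.
-- Any word w can be prescribed first, which gives density. Prescribing the bits
-- of an arbitrary τ at positions with ever growing gaps (about √(2n) of the
-- first n) and copying m elsewhere keeps the error rate o(n), and τ is read off
-- the result; prescribing τ at odd positions and contradicting m at even ones
-- makes m wrong about half of the time.
module Submission where

open import Data.Bool using (Bool; true; false; not; if_then_else_)
open import Data.Bool.Properties using () renaming (_≟_ to _≟B_)
open import Data.Empty using (⊥-elim)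
open import Data.List using ([]; _∷_; _++_; [_]; length)
open import Data.Nat using (ℕ; zero; suc; _+_; _*_; _∸_; _≤_; _<_; z≤n; s≤s; _≤?_; _<?_)
open import Data.Nat.Properties
open import Algebra.Properties.CommutativeSemigroup +-commutativeSemigroup
  using (x∙yz≈y∙xz)
open import Data.Nat.Tactic.RingSolver using (solve-∀)
open import Data.Product using (∃; _×_; _,_)
open import Function using (_∘_; id)
open import Relation.Binary.PropositionalEquality
  using (_≡_; refl; sym; trans; subst; cong; cong₂; module ≡-Reasoning)
open import Relation.Nullary using (¬_; does; yes; no)

open import Defs

data Move : Set where
  agree disagree : Move
  put : Bool → Move

Plan : Set
Plan = ℕ → Move

apply : Move → Bool → Bool
apply agree    b = b
apply disagree b = not b
apply (put c)  _ = c

isAgree : Move → Bool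
isAgree agree = true
isAgree _     = false

isDisagree : Move → Bool
isDisagree disagree = true
isDisagree _        = false

isAgree-sound : ∀ μ → isAgree μ ≡ true → μ ≡ agree
isAgree-sound agree _ = refl

isDisagree-sound : ∀ μ → isDisagree μ ≡ true → μ ≡ disagree
isDisagree-sound disagree _ = refl

not-contrapositive : ∀ {a b} → (b ≡ true → a ≡ true) → not a ≡ true → not b ≡ true
not-contrapositive {b = false} _   _ = refl
not-contrapositive {false} {true} b⇒a _ with b⇒a refl
... | ()

playPrefix : Extrapolator → Plan → ℕ → 𝓑*
playPrefix m π zero    = []
playPrefix m π (suc n) = playPrefix m π n ++ [ apply (π n) (m (playPrefix m π n)) ]

play : Extrapolator → Plan → 𝓒
play m π i = apply (π i) (m (playPrefix m π i))

prefix-snoc : ∀ σ k → prefix σ (suc k) ≡ prefix σ k ++ [ σ k ]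
prefix-snoc σ zero    = refl
prefix-snoc σ (suc k) = cong (σ zero ∷_) (prefix-snoc (σ ∘ suc) k)

prefix-play : ∀ m π k → prefix (play m π) k ≡ playPrefix m π k
prefix-play m π zero    = refl
prefix-play m π (suc k) =
  trans (prefix-snoc (play m π) k) (cong (_++ [ play m π k ]) (prefix-play m π k))

play-unfold : ∀ m π i → play m π i ≡ apply (π i) (m (prefix (play m π) i))
play-unfold m π i = cong (apply (π i) ∘ m) (sym (prefix-play m π i))

play-put : ∀ m π i {b} → π i ≡ put b → play m π i ≡ b
play-put m π i eq = cong (λ μ → apply μ (m (playPrefix m π i))) eq

indicator : Bool → ℕ
indicator b = if b then 1 else 0

count : (ℕ → Bool) → ℕ → ℕ
count P zero    = 0
count P (suc n) = indicator (P 0) + count (P ∘ suc) n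

count-≤ : ∀ P n → count P n ≤ n
count-≤ P zero    = z≤n
count-≤ P (suc n) with P 0
... | true  = s≤s (count-≤ (P ∘ suc) n)
... | false = m≤n⇒m≤1+n (count-≤ (P ∘ suc) n)

count-monoʳ : ∀ P {m n} → m ≤ n → count P m ≤ count P n
count-monoʳ P z≤n       = z≤n
count-monoʳ P (s≤s m≤n) = +-monoʳ-≤ (indicator (P 0)) (count-monoʳ (P ∘ suc) m≤n)

count-mono : ∀ {P Q} → (∀ i → P i ≡ true → Q i ≡ true) → ∀ n → count P n ≤ count Q n
count-mono P⇒Q zero = z≤n
count-mono {P} {Q} P⇒Q (suc n) =
  +-mono-≤ (indicator-mono (P 0) (Q 0) (P⇒Q 0)) (count-mono (P⇒Q ∘ suc) n)
  where
  indicator-mono : ∀ a b → (a ≡ true → b ≡ true) → indicator a ≤ indicator b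
  indicator-mono false b   _   = z≤n
  indicator-mono true  b a⇒b rewrite a⇒b refl = ≤-refl

count-cong : ∀ {P Q} → (∀ i → P i ≡ Q i) → ∀ n → count P n ≡ count Q n
count-cong P≡Q zero    = refl
count-cong P≡Q (suc n) = cong₂ _+_ (cong indicator (P≡Q 0)) (count-cong (P≡Q ∘ suc) n)

count-snoc : ∀ P n → count P (suc n) ≡ count P n + indicator (P n)
count-snoc P zero    = +-identityʳ (indicator (P 0))
count-snoc P (suc n) =
  trans (cong (indicator (P 0) +_) (count-snoc (P ∘ suc) n))
        (sym (+-assoc (indicator (P 0)) (count (P ∘ suc) n) (indicator (P (suc n)))))

count-+ : ∀ P k n → count P (k + n) ≡ count P k + count (λ i → P (k + i)) n
count-+ P zero    n = refl
count-+ P (suc k) n =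
  trans (cong (indicator (P 0) +_) (count-+ (P ∘ suc) k n))
        (sym (+-assoc (indicator (P 0)) (count (P ∘ suc) k) (count (λ i → P (suc k + i)) n)))

count-complement : ∀ P n → count P n + count (not ∘ P) n ≡ n
count-complement P zero    = refl
count-complement P (suc n) with P 0
... | true  = cong suc (count-complement (P ∘ suc) n)
... | false = trans (+-suc (count (P ∘ suc) n) _) (cong suc (count-complement (P ∘ suc) n))

hit : Extrapolator → 𝓒 → ℕ → Bool
hit m σ k = does (m (prefix σ k) ≟B σ k)

mistakes : Extrapolator → 𝓒 → ℕ → ℕ
mistakes m σ n = n ∸ correct m σ n

-- `correct` scores the predictions of the bits 1 … n, never that of bit 0.
correct≡count : ∀ m σ n → correct m σ n ≡ count (hit m σ ∘ suc) n
correct≡count m σ zero    = refl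
correct≡count m σ (suc n) = begin
  indicator (hit m σ (suc n)) + correct m σ n           ≡⟨ +-comm _ (correct m σ n) ⟩
  correct m σ n + indicator (hit m σ (suc n))           ≡⟨ cong (_+ indicator (hit m σ (suc n))) (correct≡count m σ n) ⟩
  count (hit m σ ∘ suc) n + indicator (hit m σ (suc n)) ≡⟨ count-snoc (hit m σ ∘ suc) n ⟨
  count (hit m σ ∘ suc) (suc n)                         ∎
  where open ≡-Reasoning

mistakes≡count : ∀ m σ n → mistakes m σ n ≡ count (not ∘ hit m σ ∘ suc) n
mistakes≡count m σ n = begin
  n ∸ correct m σ n                  ≡⟨ cong₂ _∸_ (sym (count-complement P n)) (correct≡count m σ n) ⟩
  count P n + count (not ∘ P) n ∸ count P n ≡⟨ m+n∸m≡n (count P n) _ ⟩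
  count (not ∘ P) n                  ∎
  where
  open ≡-Reasoning
  P = hit m σ ∘ suc

hit-agree : ∀ m π {k} → π k ≡ agree → hit m (play m π) k ≡ true
hit-agree m π {k} eq rewrite play-unfold m π k | eq = agrees (m (prefix (play m π) k))
  where
  agrees : ∀ b → does (b ≟B b) ≡ true
  agrees false = refl
  agrees true  = refl

hit-disagree : ∀ m π {k} → π k ≡ disagree → hit m (play m π) k ≡ false
hit-disagree m π {k} eq rewrite play-unfold m π k | eq = differs (m (prefix (play m π) k))
  where
  differs : ∀ b → does (b ≟B not b) ≡ false
  differs false = refl
  differs true  = refl

mistakes-play-≤ : ∀ m π n → mistakes m (play m π) n ≤ count (not ∘ isAgree ∘ π) (suc n)
mistakes-play-≤ m π n = begin
  mistakes m (play m π) n                  ≡⟨ mistakes≡count m (play m π) n ⟩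
  count (not ∘ hit m (play m π) ∘ suc) n   ≤⟨ count-mono (not-contrapositive ∘ agree⇒hit ∘ suc) n ⟩
  count (not ∘ isAgree ∘ π ∘ suc) n        ≤⟨ m≤n+m _ _ ⟩
  count (not ∘ isAgree ∘ π) (suc n)        ∎
  where
  open ≤-Reasoning
  agree⇒hit : ∀ i → isAgree (π i) ≡ true → hit m (play m π) i ≡ true
  agree⇒hit i = hit-agree m π ∘ isAgree-sound (π i)

mistakes-play-≥ : ∀ m π n → count (isDisagree ∘ π) n ≤ suc (mistakes m (play m π) n)
mistakes-play-≥ m π n = begin
  count (isDisagree ∘ π) n                         ≤⟨ count-monoʳ (isDisagree ∘ π) (n≤1+n n) ⟩
  indicator (isDisagree (π 0)) + count (isDisagree ∘ π ∘ suc) n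
    ≤⟨ +-mono-≤ (indicator≤1 (isDisagree (π 0))) (count-mono (disagree⇒miss ∘ suc) n) ⟩
  suc (count (not ∘ hit m (play m π) ∘ suc) n)     ≡⟨ cong suc (mistakes≡count m (play m π) n) ⟨
  suc (mistakes m (play m π) n)                    ∎
  where
  open ≤-Reasoning
  indicator≤1 : ∀ b → indicator b ≤ 1
  indicator≤1 false = z≤n
  indicator≤1 true  = ≤-refl
  disagree⇒miss : ∀ i → isDisagree (π i) ≡ true → not (hit m (play m π) i) ≡ true
  disagree⇒miss i = cong not ∘ hit-disagree m π ∘ isDisagree-sound (π i)

Negligible : (ℕ → ℕ) → Set
Negligible e = ∀ j → ∃ λ D → ∀ n → suc j * e n ≤ n + D

-- Apply the hypothesis to 2(j + 1) in place of j + 1 and halve.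
negligible⇒learns : ∀ m σ → Negligible (mistakes m σ) → WeaklyNVLearns m σ
negligible⇒learns m σ negligible j with negligible (j + suc j)
... | D , bound = D , λ n D≤n → half (subst (_≤ n + n)
  (*-distribʳ-+ (mistakes m σ n) (suc j) (suc j)) (≤-trans (bound n) (+-monoʳ-≤ n D≤n)))
  where
  half : ∀ {a n} → a + a ≤ n + n → a ≤ n
  half {a} {n} le with a ≤? n
  ... | yes a≤n = a≤n
  ... | no  a≰n = ⊥-elim (<⇒≱ (+-mono-< (≰⇒> a≰n) (≰⇒> a≰n)) le)

frequentlyWrong⇒¬learns : ∀ m σ → (∀ N → ∃ λ n → N ≤ n × n < 4 * mistakes m σ n) →
  ¬ WeaklyNVLearns m σ
frequentlyWrong⇒¬learns m σ often learns with learns 3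
... | N , eventually with often N
... | n , N≤n , n<4e = <⇒≱ n<4e (eventually n N≤n)

prepend : 𝓑* → Plan → Plan
prepend []      π i       = π i
prepend (b ∷ w) π zero    = put b
prepend (b ∷ w) π (suc i) = prepend w π i

prepend-skip : ∀ w π i → prepend w π (length w + i) ≡ π i
prepend-skip []      π i = refl
prepend-skip (b ∷ w) π i = prepend-skip w π i

prepend-begins : ∀ w π (p : ℕ → Bool) → prefix (λ i → apply (prepend w π i) (p i)) (length w) ≡ w
prepend-begins []      π p = refl
prepend-begins (b ∷ w) π p = cong (b ∷_) (prepend-begins w π (p ∘ suc))

play-prepend-begins : ∀ m w π → BeginsWith (play m (prepend w π)) w
play-prepend-begins m w π = prepend-begins w π (m ∘ playPrefix m (prepend w π))

count-prepend-≤ : ∀ Q w π n → count (Q ∘ prepend w π) n ≤ length w + count (Q ∘ π) n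
count-prepend-≤ Q w π n = begin
  count P n                                          ≤⟨ count-monoʳ P (m≤n+m n (length w)) ⟩
  count P (length w + n)                             ≡⟨ count-+ P (length w) n ⟩
  count P (length w) + count (λ i → P (length w + i)) n
    ≤⟨ +-mono-≤ (count-≤ P (length w)) (≤-reflexive (count-cong (cong Q ∘ prepend-skip w π) n)) ⟩
  length w + count (Q ∘ π) n                         ∎
  where
  open ≤-Reasoning
  P = Q ∘ prepend w π

count-prepend-≥ : ∀ Q w π n → count (Q ∘ π) n ≤ count (Q ∘ prepend w π) (length w + n)
count-prepend-≥ Q w π n = begin
  count (Q ∘ π) n                                    ≡⟨ count-cong (cong Q ∘ prepend-skip w π) n ⟨
  count (λ i → P (length w + i)) n                   ≤⟨ m≤n+m _ _ ⟩
  count P (length w) + count (λ i → P (length w + i)) n ≡⟨ count-+ P (length w) n ⟨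
  count P (length w + n)                             ∎
  where
  open ≤-Reasoning
  P = Q ∘ prepend w π

spread : ℕ → ℕ → (ℕ → Bool) → Plan
spread g zero    τ zero    = put (τ 0)
spread g zero    τ (suc i) = spread (suc g) (suc g) (τ ∘ suc) i
spread g (suc c) τ zero    = agree
spread g (suc c) τ (suc i) = spread g c τ i

spreadPos : ℕ → ℕ → ℕ → ℕ
spreadPos g (suc c) k       = suc (spreadPos g c k)
spreadPos g zero    zero    = zero
spreadPos g zero    (suc k) = suc (spreadPos (suc g) (suc g) k)

spread-put : ∀ g c τ k → spread g c τ (spreadPos g c k) ≡ put (τ k)
spread-put g (suc c) τ k       = spread-put g c τ k
spread-put g zero    τ zero    = refl
spread-put g zero    τ (suc k) = spread-put (suc g) (suc g) (τ ∘ suc) k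

potential-step : ∀ j g → j + j * (j ∸ suc g) ≤ g + j * (j ∸ g)
potential-step j g with g <? j
... | yes g<j = begin
  j + j * (j ∸ suc g)   ≡⟨ *-suc j (j ∸ suc g) ⟨
  j * suc (j ∸ suc g)   ≡⟨ cong (j *_) (+-∸-assoc 1 g<j) ⟨
  j * (j ∸ g)           ≤⟨ m≤n+m _ g ⟩
  g + j * (j ∸ g)       ∎
  where open ≤-Reasoning
... | no  g≮j = begin
  j + j * (j ∸ suc g)   ≡⟨ cong (λ d → j + j * d) (m≤n⇒m∸n≡0 (m≤n⇒m≤1+n j≤g)) ⟩
  j + j * 0             ≤⟨ +-monoˡ-≤ (j * 0) j≤g ⟩
  g + j * 0             ≡⟨ cong (λ d → g + j * d) (m≤n⇒m∸n≡0 j≤g) ⟨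
  g + j * (j ∸ g)       ∎
  where
  open ≤-Reasoning
  j≤g = ≮⇒≥ g≮j

-- After the gap has grown to j, every prescribed bit is followed by at least j
-- copying positions; j * (j ∸ g) pays for the prescribed bits before that.
spread-sparse : ∀ j g c τ n → c ≤ g →
  suc j * count (not ∘ isAgree ∘ spread g c τ) n + c ≤ n + (g + j * (j ∸ g))
spread-sparse j g c τ zero c≤g = begin
  suc j * 0 + c         ≡⟨ cong (_+ c) (*-zeroʳ (suc j)) ⟩
  c                     ≤⟨ ≤-trans c≤g (m≤m+n g _) ⟩
  g + j * (j ∸ g)       ∎
  where open ≤-Reasoning
spread-sparse j g (suc c) τ (suc n) c<g = begin
  suc j * X + suc c     ≡⟨ +-suc (suc j * X) c ⟩
  suc (suc j * X + c)   ≤⟨ s≤s (spread-sparse j g c τ n (<⇒≤ c<g)) ⟩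
  suc n + (g + j * (j ∸ g)) ∎
  where
  open ≤-Reasoning
  X = count (not ∘ isAgree ∘ spread g c τ) n
spread-sparse j g zero τ (suc n) _ = begin
  suc j * suc Y + 0                ≡⟨ trans (+-identityʳ _) (*-suc (suc j) Y) ⟩
  suc j + suc j * Y                ≤⟨ +-monoʳ-≤ (suc j) tail-sparse ⟩
  suc j + (n + j * (j ∸ suc g))    ≡⟨ cong suc (x∙yz≈y∙xz j n _) ⟩
  suc (n + (j + j * (j ∸ suc g)))  ≤⟨ s≤s (+-monoʳ-≤ n (potential-step j g)) ⟩
  suc n + (g + j * (j ∸ g))        ∎
  where
  open ≤-Reasoning
  Y = count (not ∘ isAgree ∘ spread (suc g) (suc g) (τ ∘ suc)) n
  tail-sparse : suc j * Y ≤ n + j * (j ∸ suc g)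
  tail-sparse = +-cancelʳ-≤ (suc g) _ _ (begin
    suc j * Y + suc g                    ≤⟨ spread-sparse j (suc g) (suc g) (τ ∘ suc) n ≤-refl ⟩
    n + (suc g + j * (j ∸ suc g))        ≡⟨ x∙yz≈y∙xz n (suc g) _ ⟩
    suc g + (n + j * (j ∸ suc g))        ≡⟨ +-comm (suc g) _ ⟩
    n + j * (j ∸ suc g) + suc g          ∎)

spread-sparse₀ : ∀ j τ n → suc j * count (not ∘ isAgree ∘ spread 0 0 τ) n ≤ n + j * j
spread-sparse₀ j τ n =
  subst (_≤ n + j * j) (+-identityʳ _) (spread-sparse j 0 0 τ n z≤n)

learns-spread : ∀ m w τ → WeaklyNVLearns m (play m (prepend w (spread 0 0 τ)))
learns-spread m w τ = negligible⇒learns m σ λ j → suc (suc j * length w + j * j) , bound j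
  where
  σ = play m (prepend w (spread 0 0 τ))
  bound : ∀ j n → suc j * mistakes m σ n ≤ n + suc (suc j * length w + j * j)
  bound j n = begin
    suc j * mistakes m σ n
      ≤⟨ *-monoʳ-≤ (suc j) (mistakes-play-≤ m (prepend w (spread 0 0 τ)) n) ⟩
    suc j * count (not ∘ isAgree ∘ prepend w (spread 0 0 τ)) (suc n)
      ≤⟨ *-monoʳ-≤ (suc j) (count-prepend-≤ (not ∘ isAgree) w (spread 0 0 τ) (suc n)) ⟩
    suc j * (length w + X)                     ≡⟨ *-distribˡ-+ (suc j) (length w) X ⟩
    suc j * length w + suc j * X               ≤⟨ +-monoʳ-≤ _ (spread-sparse₀ j τ (suc n)) ⟩
    suc j * length w + (suc n + j * j)         ≡⟨ x∙yz≈y∙xz _ (suc n) _ ⟩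
    suc (n + (suc j * length w + j * j))       ≡⟨ +-suc n _ ⟨
    n + suc (suc j * length w + j * j)         ∎
    where
    open ≤-Reasoning
    X = count (not ∘ isAgree ∘ spread 0 0 τ) (suc n)

alternate : (ℕ → Bool) → Plan
alternate τ zero          = disagree
alternate τ (suc zero)    = put (τ 0)
alternate τ (suc (suc i)) = alternate (τ ∘ suc) i

alternate-put : ∀ τ k → alternate τ (suc (k * 2)) ≡ put (τ k)
alternate-put τ zero    = refl
alternate-put τ (suc k) = alternate-put (τ ∘ suc) k

alternate-disagrees : ∀ τ r → count (isDisagree ∘ alternate τ) (r * 2) ≡ r
alternate-disagrees τ zero    = refl
alternate-disagrees τ (suc r) = cong suc (alternate-disagrees (τ ∘ suc) r)

¬learns-alternate : ∀ m w τ → ¬ WeaklyNVLearns m (play m (prepend w (alternate τ)))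
¬learns-alternate m w τ = frequentlyWrong⇒¬learns m σ often
  where
  π = prepend w (alternate τ)
  σ = play m π
  often : ∀ N → ∃ λ n → N ≤ n × n < 4 * mistakes m σ n
  often N = n , N≤n , n<4e
    where
    L = length w
    r = L + N + 3
    n = L + r * 2
    e = mistakes m σ n
    N≤n : N ≤ n
    N≤n = ≤-trans (m≤n+m N L) (≤-trans (m≤m+n (L + N) 3) (≤-trans (m≤m*n r 2) (m≤n+m _ L)))
    r≤1+e : r ≤ suc e
    r≤1+e = begin
      r                                    ≡⟨ alternate-disagrees τ r ⟨
      count (isDisagree ∘ alternate τ) (r * 2) ≤⟨ count-prepend-≥ isDisagree w (alternate τ) (r * 2) ⟩
      count (isDisagree ∘ π) n             ≤⟨ mistakes-play-≥ m π n ⟩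
      suc e                                ∎
      where open ≤-Reasoning
    slack : ∀ L N → 4 * (L + N + 3) ≡ 4 + suc (L + (L + N + 3) * 2) + (L + N * 2 + 1)
    slack = solve-∀
    n<4e : n < 4 * e
    n<4e = +-cancelˡ-≤ 4 _ _ (begin
      4 + suc n                 ≤⟨ m≤m+n _ _ ⟩
      4 + suc n + (L + N * 2 + 1) ≡⟨ slack L N ⟨
      4 * r                     ≤⟨ *-monoʳ-≤ 4 r≤1+e ⟩
      4 * suc e                 ≡⟨ *-suc 4 e ⟩
      4 + 4 * e                 ∎)
      where open ≤-Reasoning

readable⇒injective : ∀ (f : 𝓒 → 𝓒) (pos : ℕ → ℕ) → (∀ τ k → f τ (pos k) ≡ τ k) →
  ∀ τ τ' → f τ ≈ f τ' → τ ≈ τ'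
readable⇒injective f pos read τ τ' f≈ k = trans (sym (read τ k)) (trans (f≈ (pos k)) (read τ' k))

dense-continuum-within : ∀ (P : 𝓒 → Set) (F : 𝓑* → 𝓒 → 𝓒) (pos : ℕ → ℕ) →
  (∀ w τ → P (F w τ)) → (∀ w τ → BeginsWith (F w τ) w) → (∀ τ k → F [] τ (pos k) ≡ τ k) →
  ∃ λ (S : 𝓒 → Set) → Dense S × HasCardContinuum S × (∀ σ → S σ → P σ)
dense-continuum-within P F pos inP begins read =
  P ,
  (λ w → F w τ₀ , inP w τ₀ , begins w τ₀) ,
  (F [] , inP [] , readable⇒injective (F []) pos read) ,
  λ _ → id
  where
  τ₀ : 𝓒
  τ₀ _ = false

proposition5 : ∀ (m : Extrapolator) →
    (∃ λ (S : 𝓒 → Set) → Dense S × HasCardContinuum S × (∀ σ → S σ → WeaklyNVLearns m σ))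
    × (∃ λ (S : 𝓒 → Set) → Dense S × HasCardContinuum S × (∀ σ → S σ → ¬ WeaklyNVLearns m σ))
proposition5 m =
  dense-continuum-within _ learnable (spreadPos 0 0) (learns-spread m)
    (λ w τ → play-prepend-begins m w (spread 0 0 τ))
    (λ τ k → play-put m (spread 0 0 τ) (spreadPos 0 0 k) (spread-put 0 0 τ k)) ,
  dense-continuum-within _ unlearnable (λ k → suc (k * 2)) (¬learns-alternate m)
    (λ w τ → play-prepend-begins m w (alternate τ))
    (λ τ k → play-put m (alternate τ) (suc (k * 2)) (alternate-put τ k))
  where
  learnable unlearnable : 𝓑* → 𝓒 → 𝓒
  learnable   w τ = play m (prepend w (spread 0 0 τ))
  unlearnable w τ = play m (prepend w (alternate τ))
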